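{- Let $G=(V,E)$ be a graph on $n$ vertices with maximum degree $\Delta$. Let $\mathcal B$ be the family of sets $B\subseteq V$ such that the induced subgraph $G[B]$ is bipartite, let $\max\mathcal B$ be the family of inclusion-maximal members of $\mathcal B$, and let $\uparrow\max\mathcal B=\{T\subseteq V : \text{there exists } S\in\max\mathcal B \text{ with } S\subseteq T\}$. Then \[ |\uparrow\max\mathcal B| \le (2^{\Delta+1}-\Delta-1)^{n/(\Delta+1)}. \]
   Context: $G[B]$ denotes the subgraph of $G$ induced by the vertex set $B$. -}

module Defs where

open import Data.Nat using (ℕ; _≤_; _<_)
open import Data.Bool using (Bool; true; false)
open import Data.Fin using (Fin)
open import Data.Fin.Subset using (Subset; _∈_; _⊆_; ∣_∣)
open import Data.Vec using (tabulate)
open import Data.Product using (Σ; ∃; _×_)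
open import Data.Sum using (_⊎_)
open import Relation.Binary.PropositionalEquality using (_≡_; _≢_)

record Graph (n : ℕ) : Set where
  field
    adj   : Fin n → Fin n → Bool
    sym   : ∀ u v → adj u v ≡ adj v u
    irrfl : ∀ v → adj v v ≡ false
open Graph public

N : ∀ {n} → Graph n → Fin n → Subset n
N G v = tabulate (λ w → adj G v w)

deg : ∀ {n} → Graph n → Fin n → ℕ
deg G v = ∣ N G v ∣

-- Δ is the maximum degree of G (maximum over the empty vertex set taken to be 0)
MaxDegree : ∀ {n} → Graph n → ℕ → Set
MaxDegree {n} G Δ = (∀ v → deg G v ≤ Δ) × (Δ ≡ 0 ⊎ ∃ λ v → deg G v ≡ Δ)

InducedBipartite : ∀ {n} → Graph n → Subset n → Set
InducedBipartite {n} G B =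
  Σ (Fin n → Bool) λ c → ∀ u v → u ∈ B → v ∈ B → adj G u v ≡ true → c u ≢ c v

MaximalBipartite : ∀ {n} → Graph n → Subset n → Set
MaximalBipartite {n} G B =
  InducedBipartite G B × (∀ (B′ : Subset n) → B ⊆ B′ → InducedBipartite G B′ → B′ ≡ B)

InUpMax : ∀ {n} → Graph n → Subset n → Set
InUpMax {n} G T = ∃ λ (S : Subset n) → MaximalBipartite G S × S ⊆ T

module Submission where

-- For every vertex v,
-- each T ∈ F contains v or at least two neighbours of v: otherwise S ∪ {v} would still induce
-- a bipartite graph (colour v opposite to its unique neighbour in S), contradicting maximality.
-- So the traces of F on the closed neighbourhood N[v] avoid 1 + deg v of its 2^(1 + deg v)
-- subsets.  Adding Δ − deg v copies of the window {v} covers every vertex Δ + 1 times, and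
-- Shearer's lemma gives  |F|^(Δ+1) ≤ ∏_v (2^(1+deg v) − 1 − deg v) · 2^(Δ − deg v) ≤ (2^(Δ+1) − Δ − 1)^n.

open import Defs hiding (sym)
open import Data.Nat hiding (_≟_)
open import Data.Nat.Properties hiding (_≟_)
open import Data.Nat.ListAction using (sum; product)
open import Data.Nat.ListAction.Properties using (sum-++; product-++)
open import Data.Nat.Tactic.RingSolver using (solve-∀)
open import Algebra.Properties.CommutativeMonoid.Sum +-0-commutativeMonoid using (sum-syntax; ∑-distrib-+)
open import Data.Bool using (Bool; true; false; if_then_else_; _∨_; _∧_; not)
import Data.Bool as Bool
open import Data.Bool.Properties using (∨-zeroʳ; T-≡; not-¬)
open import Data.Fin using (Fin; zero; suc; _≟_)
open import Data.Fin.Properties using (any?)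
open import Data.Fin.Subset using (Subset; _∈_; _∉_; _∪_; ⁅_⁆; ∣_∣)
open import Data.Fin.Subset.Properties using (_∈?_; x∈⁅x⁆; x∈⁅y⁆⇒x≡y; x∈p∪q⁻; x∈p∪q⁺; p⊆p∪q; ∣⁅x⁆∣≡1)
open import Data.Vec using ([]; _∷_; lookup; tail; tabulate; here; there)
open import Data.Vec.Properties using (lookup-zipWith; lookup-replicate; lookup⇒[]=; []=⇒lookup; lookup∘tabulate)
open import Data.List using (List; []; _∷_; length; map; _++_; replicate; zipWith; take; drop; concat)
import Data.List as List
open import Data.List.Properties
  using (take++drop≡id; length-take; length-drop; length-++; length-map; length-replicate; length-zipWith;
         map-++; map-replicate)
open import Data.List.Relation.Unary.All as All using (All; []; _∷_)
open import Data.List.Relation.Unary.All.Properties using (map⁺; concat⁺; tabulate⁺; replicate⁺)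
open import Data.List.Relation.Unary.AllPairs using ([]; _∷_)
open import Data.List.Relation.Unary.Unique.Propositional using (Unique)
open import Data.Product using (∃; _×_; _,_; proj₁; proj₂)
open import Data.Sum using (inj₁; inj₂)
open import Data.Unit using (⊤; tt)
open import Function.Bundles using (Equivalence)
open import Relation.Binary.PropositionalEquality
open import Relation.Nullary using (Dec; yes; no; contradiction)
open import Relation.Nullary.Decidable using (_×-dec_)

^-distribʳ-* : ∀ a b n → (a * b) ^ n ≡ a ^ n * b ^ n
^-distribʳ-* a b zero    = refl
^-distribʳ-* a b (suc n) = trans (cong ((a * b) *_) (^-distribʳ-* a b n)) (*-interchange a b (a ^ n) (b ^ n))
  where
  *-interchange : ∀ a b c d → (a * b) * (c * d) ≡ (a * c) * (b * d)
  *-interchange = solve-∀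

^-swap : ∀ x p q → (x ^ p) ^ q ≡ (x ^ q) ^ p
^-swap x p q = trans (^-*-assoc x p q) (trans (cong (x ^_) (*-comm p q)) (sym (^-*-assoc x q p)))

^-cancelʳ-≤ : ∀ k a b → a ^ suc k ≤ b ^ suc k → a ≤ b
^-cancelʳ-≤ k a b h with a ≤? b
... | yes a≤b = a≤b
... | no  a≰b = contradiction h (<⇒≱ (^-monoˡ-< (suc k) (≰⇒> a≰b)))

-- Two-term AM–GM, squared, for ordered arguments: with v = u + d,
-- (u + v)² = 4uv + d².
amgm₂-ordered : ∀ u v → u ≤ v → 4 * (u * v) ≤ (u + v) * (u + v)
amgm₂-ordered u v u≤v =
  subst (λ w → 4 * (u * w) ≤ (u + w) * (u + w)) (m+[n∸m]≡n u≤v) (gap u (v ∸ u))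
  where
  square : ∀ u d → 4 * (u * (u + d)) + d * d ≡ (u + (u + d)) * (u + (u + d))
  square = solve-∀
  gap : ∀ u d → 4 * (u * (u + d)) ≤ (u + (u + d)) * (u + (u + d))
  gap u d = subst (4 * (u * (u + d)) ≤_) (square u d) (m≤m+n _ (d * d))

amgm₂ : ∀ u v → 4 * (u * v) ≤ (u + v) * (u + v)
amgm₂ u v with ≤-total u v
... | inj₁ u≤v = amgm₂-ordered u v u≤v
... | inj₂ v≤u = subst₂ _≤_ (cong (4 *_) (*-comm v u)) (cong₂ _*_ (+-comm v u) (+-comm v u))
                   (amgm₂-ordered v u v≤u)

square-^ : ∀ x m → (x * x) ^ m ≡ x ^ (2 * m)
square-^ x m = trans (cong (λ y → (x * y) ^ m) (sym (*-identityʳ x))) (^-*-assoc x 2 m)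

-- AM–GM for lists of length 2^m, by halving (Cauchy):  M^M · ∏ys ≤ (∑ys)^M  where M = 2^m.
amgm-pow2 : ∀ m (ys : List ℕ) → length ys ≡ 2 ^ m → (2 ^ m) ^ (2 ^ m) * product ys ≤ sum ys ^ (2 ^ m)
amgm-pow2 zero (y ∷ []) refl = ≤-reflexive (singleton y)
  where
  singleton : ∀ y → 1 * (y * 1) ≡ (y + 0) * 1
  singleton = solve-∀
amgm-pow2 (suc m) ys len = begin
    (2 * H) ^ (2 * H) * product ys
      ≡⟨ cong₂ _*_ double-power (trans (cong product (sym (take++drop≡id H ys))) (product-++ l r)) ⟩
    (4 ^ H * (H ^ H * H ^ H)) * (product l * product r)
      ≡⟨ regroup (4 ^ H) (H ^ H) (product l) (product r) ⟩
    4 ^ H * ((H ^ H * product l) * (H ^ H * product r))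
      ≤⟨ *-monoʳ-≤ (4 ^ H) (*-mono-≤ (amgm-pow2 m l length-l) (amgm-pow2 m r length-r)) ⟩
    4 ^ H * (sum l ^ H * sum r ^ H)
      ≡⟨ sym (trans (^-distribʳ-* 4 (sum l * sum r) H) (cong (4 ^ H *_) (^-distribʳ-* (sum l) (sum r) H))) ⟩
    (4 * (sum l * sum r)) ^ H
      ≤⟨ ^-monoˡ-≤ H (amgm₂ (sum l) (sum r)) ⟩
    ((sum l + sum r) * (sum l + sum r)) ^ H
      ≡⟨ square-^ (sum l + sum r) H ⟩
    (sum l + sum r) ^ (2 * H)
      ≡⟨ cong (_^ (2 * H)) (trans (sym (sum-++ l r)) (cong sum (take++drop≡id H ys))) ⟩
    sum ys ^ (2 * H) ∎
  where
  open ≤-Reasoning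
  H = 2 ^ m
  l = take H ys
  r = drop H ys
  length-l : length l ≡ H
  length-l = trans (length-take H ys) (trans (cong (H ⊓_) len) (m≤n⇒m⊓n≡m (m≤m+n H (H + 0))))
  length-r : length r ≡ H
  length-r = trans (length-drop H ys) (trans (cong (_∸ H) len) (trans (m+n∸m≡n H (H + 0)) (+-identityʳ H)))
  double-power : (2 * H) ^ (2 * H) ≡ 4 ^ H * (H ^ H * H ^ H)
  double-power = begin-equality
    (2 * H) ^ (2 * H)        ≡⟨ sym (square-^ (2 * H) H) ⟩
    ((2 * H) * (2 * H)) ^ H  ≡⟨ cong (_^ H) (four-square H) ⟩
    (4 * (H * H)) ^ H        ≡⟨ ^-distribʳ-* 4 (H * H) H ⟩
    4 ^ H * (H * H) ^ H      ≡⟨ cong (4 ^ H *_) (^-distribʳ-* H H H) ⟩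
    4 ^ H * (H ^ H * H ^ H)  ∎
    where
    four-square : ∀ H → (2 * H) * (2 * H) ≡ 4 * (H * H)
    four-square = solve-∀
  regroup : ∀ a b p q → (a * (b * b)) * (p * q) ≡ a * ((b * p) * (b * q))
  regroup = solve-∀

product-map-* : ∀ c ys → product (map (c *_) ys) ≡ c ^ length ys * product ys
product-map-* c []       = refl
product-map-* c (y ∷ ys) = trans (cong ((c * y) *_) (product-map-* c ys)) (interchange c y _ _)
  where
  interchange : ∀ a b c d → (a * b) * (c * d) ≡ (a * c) * (b * d)
  interchange = solve-∀

sum-map-* : ∀ c ys → sum (map (c *_) ys) ≡ c * sum ys
sum-map-* c []       = sym (*-zeroʳ c)
sum-map-* c (y ∷ ys) = trans (cong ((c * y) +_) (sum-map-* c ys)) (sym (*-distribˡ-+ c y _))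

product-replicate : ∀ r x → product (replicate r x) ≡ x ^ r
product-replicate zero    x = refl
product-replicate (suc r) x = cong (x *_) (product-replicate r x)

sum-replicate : ∀ r x → sum (replicate r x) ≡ r * x
sum-replicate zero    x = refl
sum-replicate (suc r) x = cong (x +_) (sum-replicate r x)

n≤2^n : ∀ n → n ≤ 2 ^ n
n≤2^n zero    = z≤n
n≤2^n (suc n) = +-mono-≤ (m^n>0 2 n) (≤-trans (n≤2^n n) (m≤m+n (2 ^ n) 0))

-- AM–GM:  K^K · ∏ys ≤ (∑ys)^K  for a list of length K.  The list (K·y₁, …, K·y_K)
-- is padded with copies of its mean ∑ys to length 2^K, where amgm-pow2 applies.
amgm : ∀ ys → length ys ^ length ys * product ys ≤ sum ys ^ length ys
amgm []         = ≤-refl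
amgm zs@(y ∷ _) = padded-cancel (*-cancelˡ-≤ (M ^ M) {{m^n≢0 M M {{m^n≢0 2 K}}}} padded-bound)
  where
  K = length zs
  M = 2 ^ K
  r = M ∸ K
  Σ = sum zs
  padded = map (K *_) zs ++ replicate r Σ
  K+r≡M : K + r ≡ M
  K+r≡M = m+[n∸m]≡n (n≤2^n K)
  length-padded : length padded ≡ M
  length-padded = begin-equality
    length padded                                      ≡⟨ length-++ (map (K *_) zs) ⟩
    length (map (K *_) zs) + length (replicate r Σ)    ≡⟨ cong₂ _+_ (length-map (K *_) zs) (length-replicate r) ⟩
    K + r                                              ≡⟨ K+r≡M ⟩
    M                                                  ∎
    where open ≤-Reasoning
  product-padded : product padded ≡ (K ^ K * product zs) * Σ ^ r
  product-padded = trans (product-++ (map (K *_) zs) (replicate r Σ))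
                         (cong₂ _*_ (product-map-* K zs) (product-replicate r Σ))
  sum-padded : sum padded ≡ M * Σ
  sum-padded = begin-equality
    sum padded                                   ≡⟨ sum-++ (map (K *_) zs) (replicate r Σ) ⟩
    sum (map (K *_) zs) + sum (replicate r Σ)    ≡⟨ cong₂ _+_ (sum-map-* K zs) (sum-replicate r Σ) ⟩
    K * Σ + r * Σ                                ≡⟨ sym (*-distribʳ-+ Σ K r) ⟩
    (K + r) * Σ                                  ≡⟨ cong (_* Σ) K+r≡M ⟩
    M * Σ                                        ∎
    where open ≤-Reasoning
  padded-bound : M ^ M * ((K ^ K * product zs) * Σ ^ r) ≤ M ^ M * (Σ ^ K * Σ ^ r)
  padded-bound = subst₂ _≤_ (cong (M ^ M *_) product-padded) power-of-sum (amgm-pow2 K padded length-padded)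
    where
    power-of-sum : sum padded ^ M ≡ M ^ M * (Σ ^ K * Σ ^ r)
    power-of-sum = trans (cong (_^ M) sum-padded)
      (trans (^-distribʳ-* M Σ M) (cong (M ^ M *_) (trans (cong (Σ ^_) (sym K+r≡M)) (^-distribˡ-+-* Σ K r))))
  -- cancel Σ^r; if Σ = 0 the list is all zeros and both sides vanish
  padded-cancel : (K ^ K * product zs) * Σ ^ r ≤ Σ ^ K * Σ ^ r → K ^ K * product zs ≤ Σ ^ K
  padded-cancel h with Σ in eq
  ... | suc _ = *-cancelʳ-≤ _ _ _ {{m^n≢0 (suc _) r}} h
  ... | zero  rewrite m+n≡0⇒m≡0 y eq = ≤-reflexive (*-zeroʳ (K ^ K))

-- Superadditivity of K-th roots (K = suc k): if x ≤ (Y^K/c)^{1/K} and y ≤ (Z^K/c)^{1/K},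
-- then x + y ≤ ((Y + Z)^K/c)^{1/K}.  Expanding (x + y)^K one factor at a time, every
-- mixed monomial x^p y^q (p + q = K) is bounded by Y^p Z^q.
module RootSum (k x y c Y Z : ℕ) (x-bound : x ^ suc k * c ≤ Y ^ suc k) (y-bound : y ^ suc k * c ≤ Z ^ suc k) where
  open ≤-Reasoning
  K = suc k

  -- a monomial of total degree K: its K-th power is (x^K c)^p (y^K c)^q
  monomial-bound : ∀ p q → p + q ≡ K → x ^ p * y ^ q * c ≤ Y ^ p * Z ^ q
  monomial-bound p q p+q≡K = ^-cancelʳ-≤ k _ _ (begin
     (x ^ p * y ^ q * c) ^ K
       ≡⟨ ^-distribʳ-* (x ^ p * y ^ q) c K ⟩
     (x ^ p * y ^ q) ^ K * c ^ K
       ≡⟨ cong₂ _*_ (^-distribʳ-* (x ^ p) (y ^ q) K) (trans (cong (c ^_) (sym p+q≡K)) (^-distribˡ-+-* c p q)) ⟩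
     ((x ^ p) ^ K * (y ^ q) ^ K) * (c ^ p * c ^ q)
       ≡⟨ cong₂ (λ u v → (u * v) * (c ^ p * c ^ q)) (^-swap x p K) (^-swap y q K) ⟩
     ((x ^ K) ^ p * (y ^ K) ^ q) * (c ^ p * c ^ q)
       ≡⟨ interchange ((x ^ K) ^ p) ((y ^ K) ^ q) (c ^ p) (c ^ q) ⟩
     ((x ^ K) ^ p * c ^ p) * ((y ^ K) ^ q * c ^ q)
       ≡⟨ sym (cong₂ _*_ (^-distribʳ-* (x ^ K) c p) (^-distribʳ-* (y ^ K) c q)) ⟩
     (x ^ K * c) ^ p * (y ^ K * c) ^ q
       ≤⟨ *-mono-≤ (^-monoˡ-≤ p x-bound) (^-monoˡ-≤ q y-bound) ⟩
     (Y ^ K) ^ p * (Z ^ K) ^ q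
       ≡⟨ cong₂ _*_ (^-swap Y K p) (^-swap Z K q) ⟩
     (Y ^ p) ^ K * (Z ^ q) ^ K
       ≡⟨ sym (^-distribʳ-* (Y ^ p) (Z ^ q) K) ⟩
     (Y ^ p * Z ^ q) ^ K ∎)
    where
    interchange : ∀ a b c d → (a * b) * (c * d) ≡ (a * c) * (b * d)
    interchange = solve-∀

  partial-expansion : ∀ m p q → p + q + m ≡ K → x ^ p * y ^ q * (x + y) ^ m * c ≤ Y ^ p * Z ^ q * (Y + Z) ^ m
  partial-expansion zero p q e =
    subst₂ _≤_ (cong (_* c) (sym (*-identityʳ (x ^ p * y ^ q)))) (sym (*-identityʳ (Y ^ p * Z ^ q)))
      (monomial-bound p q (trans (sym (+-identityʳ _)) e))
  partial-expansion (suc m) p q e = begin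
     x ^ p * y ^ q * ((x + y) * (x + y) ^ m) * c
       ≡⟨ split-c x y (x ^ p) (y ^ q) ((x + y) ^ m) c ⟩
     (x * x ^ p) * y ^ q * (x + y) ^ m * c + x ^ p * (y * y ^ q) * (x + y) ^ m * c
       ≤⟨ +-mono-≤ (partial-expansion m (suc p) q e₁) (partial-expansion m p (suc q) e₂) ⟩
     (Y * Y ^ p) * Z ^ q * (Y + Z) ^ m + Y ^ p * (Z * Z ^ q) * (Y + Z) ^ m
       ≡⟨ sym (split Y Z (Y ^ p) (Z ^ q) ((Y + Z) ^ m)) ⟩
     Y ^ p * Z ^ q * ((Y + Z) * (Y + Z) ^ m) ∎
    where
    e₁ : suc p + q + m ≡ K
    e₁ = trans (sym (+-suc (p + q) m)) e
    e₂ : p + suc q + m ≡ K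
    e₂ = trans (cong (_+ m) (+-suc p q)) e₁
    split-c : ∀ x y X W V c → X * W * ((x + y) * V) * c ≡ (x * X) * W * V * c + X * (y * W) * V * c
    split-c = solve-∀
    split : ∀ x y X W V → X * W * ((x + y) * V) ≡ (x * X) * W * V + X * (y * W) * V
    split = solve-∀

  root-sum : (x + y) ^ K * c ≤ (Y + Z) ^ K
  root-sum = subst₂ _≤_ (cong (_* c) (*-identityˡ ((x + y) ^ K))) (*-identityˡ ((Y + Z) ^ K))
               (partial-expansion K 0 0 refl)

-- The cofactors of s: at position i, the product of all entries of s other than the i-th.
cofactors : List ℕ → List ℕ
cofactors []       = []
cofactors (x ∷ xs) = product xs ∷ map (x *_) (cofactors xs)

length-cofactors : ∀ s → length (cofactors s) ≡ length s
length-cofactors []       = refl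
length-cofactors (x ∷ xs) = cong suc (trans (length-map (x *_) (cofactors xs)) (length-cofactors xs))

-- Every entry of s occurs in all cofactors but one:  ∏ cofactors(s) · ∏ s = (∏ s)^{length s}.
product-cofactors : ∀ s → product (cofactors s) * product s ≡ product s ^ length s
product-cofactors []       = refl
product-cofactors (x ∷ xs) = begin
  (P * product (map (x *_) C)) * (x * P)   ≡⟨ cong (λ w → (P * w) * (x * P)) (product-map-* x C) ⟩
  (P * (x ^ length C * ∏C)) * (x * P)      ≡⟨ cong (λ L → (P * (x ^ L * ∏C)) * (x * P)) (length-cofactors xs) ⟩
  (P * (x ^ L * ∏C)) * (x * P)             ≡⟨ regroup P (x ^ L) ∏C x ⟩
  (x * P) * (x ^ L * (∏C * P))             ≡⟨ cong (λ w → (x * P) * (x ^ L * w)) (product-cofactors xs) ⟩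
  (x * P) * (x ^ L * P ^ L)                ≡⟨ cong ((x * P) *_) (sym (^-distribʳ-* x P L)) ⟩
  (x * P) * (x * P) ^ L                    ∎
  where
  open ≡-Reasoning
  P = product xs
  C = cofactors xs
  ∏C = product C
  L = length xs
  regroup : ∀ P X Q x → (P * (X * Q)) * (x * P) ≡ (x * P) * (X * (Q * P))
  regroup = solve-∀

product-zipWith-* : ∀ a e → length a ≡ length e → product (zipWith _*_ a e) ≡ product a * product e
product-zipWith-* []       []       _ = refl
product-zipWith-* (a₀ ∷ a) (e₀ ∷ e) l =
  trans (cong ((a₀ * e₀) *_) (product-zipWith-* a e (suc-injective l))) (interchange a₀ e₀ _ _)
  where
  interchange : ∀ a b c d → (a * b) * (c * d) ≡ (a * c) * (b * d)
  interchange = solve-∀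

inner-map-* : ∀ c a e → sum (zipWith _*_ a (map (c *_) e)) ≡ c * sum (zipWith _*_ a e)
inner-map-* c []       e        = sym (*-zeroʳ c)
inner-map-* c (a₀ ∷ a) []       = sym (*-zeroʳ c)
inner-map-* c (a₀ ∷ a) (e₀ ∷ e) = trans (cong (a₀ * (c * e₀) +_) (inner-map-* c a e)) (factor a₀ c e₀ _)
  where
  factor : ∀ a₀ c e₀ P → a₀ * (c * e₀) + c * P ≡ c * (a₀ * e₀ + P)
  factor = solve-∀

inner-+ : ∀ a b e → length a ≡ length b →
  sum (zipWith _*_ a e) + sum (zipWith _*_ b e) ≡ sum (zipWith _*_ (zipWith _+_ a b) e)
inner-+ []       []       e        _ = refl
inner-+ (a₀ ∷ a) (b₀ ∷ b) []       _ = refl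
inner-+ (a₀ ∷ a) (b₀ ∷ b) (e₀ ∷ e) l =
  trans (regroup a₀ b₀ e₀ _ _) (cong ((a₀ + b₀) * e₀ +_) (inner-+ a b e (suc-injective l)))
  where
  regroup : ∀ a₀ b₀ e₀ A B → (a₀ * e₀ + A) + (b₀ * e₀ + B) ≡ (a₀ + b₀) * e₀ + (A + B)
  regroup = solve-∀

inner-cofactors : ∀ s → sum (zipWith _*_ s (cofactors s)) ≡ length s * product s
inner-cofactors []       = refl
inner-cofactors (x ∷ xs) =
  trans (cong (x * product xs +_) (trans (inner-map-* x xs (cofactors xs)) (cong (x *_) (inner-cofactors xs))))
        (collect x (product xs) (length xs))
  where
  collect : ∀ x P L → x * P + x * (L * P) ≡ suc L * (x * P)
  collect = solve-∀

length-zipWith-≡ : ∀ (f : ℕ → ℕ → ℕ) a b → length a ≡ length b → length (zipWith f a b) ≡ length a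
length-zipWith-≡ f a b l = trans (length-zipWith f a b) (trans (cong (length a ⊓_) (sym l)) (⊓-idem (length a)))

product-zipWith-+-zero : ∀ a b → product (zipWith _+_ a b) ≡ 0 → product a ≡ 0 × product b ≡ 0
product-zipWith-+-zero []       []       ()
product-zipWith-+-zero []       (_ ∷ _)  ()
product-zipWith-+-zero (_ ∷ _)  []       ()
product-zipWith-+-zero (a₀ ∷ a) (b₀ ∷ b) h with m*n≡0⇒m≡0∨n≡0 (a₀ + b₀) h
... | inj₁ e rewrite m+n≡0⇒m≡0 a₀ e | m+n≡0⇒n≡0 a₀ e = refl , refl
... | inj₂ e with product-zipWith-+-zero a b e
... | a≡0 , b≡0 = trans (cong (a₀ *_) a≡0) (*-zeroʳ a₀) , trans (cong (b₀ *_) b≡0) (*-zeroʳ b₀)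

-- Superadditivity of the geometric mean, for ∏(a + b) = S > 0.  With weights
-- w = cofactors(a + b), AM–GM applied to the list a·w gives (Kα)^K S^k ≤ ⟨a, w⟩^K, likewise
-- for b, and ⟨a, w⟩ + ⟨b, w⟩ = ⟨a + b, w⟩ = K S; RootSum combines the two bounds.
module GeomeanPositive (k : ℕ) (a b : List ℕ) (length-a : length a ≡ suc k) (length-b : length b ≡ suc k)
                       (S' : ℕ) (product-s : product (zipWith _+_ a b) ≡ suc S') where
  open ≤-Reasoning
  K = suc k
  S = suc S'
  s = zipWith _+_ a b
  w = cofactors s

  length-s : length s ≡ K
  length-s = trans (length-zipWith-≡ _+_ a b (trans length-a (sym length-b))) length-a

  length-w : length w ≡ K
  length-w = trans (length-cofactors s) length-s

  weighted-amgm : ∀ c γ → length c ≡ K → γ ^ K ≤ product c → (K * γ) ^ K * S ^ k ≤ sum (zipWith _*_ c w) ^ K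
  weighted-amgm c γ length-c γ-bound = *-cancelʳ-≤ _ _ S (begin
      (K * γ) ^ K * S ^ k * S        ≡⟨ cong (λ z → z * S ^ k * S) (^-distribʳ-* K γ K) ⟩
      K ^ K * γ ^ K * S ^ k * S      ≡⟨ regroup (K ^ K) (γ ^ K) (S ^ k) S ⟩
      K ^ K * (γ ^ K * S ^ K)        ≤⟨ *-monoʳ-≤ (K ^ K) (*-monoˡ-≤ (S ^ K) γ-bound) ⟩
      K ^ K * (product c * S ^ K)    ≡⟨ cong (K ^ K *_) (sym product-y) ⟩
      K ^ K * (product y * S)        ≡⟨ sym (*-assoc (K ^ K) (product y) S) ⟩
      K ^ K * product y * S          ≤⟨ *-monoˡ-≤ S amgm-y ⟩
      sum y ^ K * S                  ∎)
    where
    y = zipWith _*_ c w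
    length-y : length y ≡ K
    length-y = trans (length-zipWith-≡ _*_ c w (trans length-c (sym length-w))) length-c
    amgm-y : K ^ K * product y ≤ sum y ^ K
    amgm-y = subst (λ L → L ^ L * product y ≤ sum y ^ L) length-y (amgm y)
    product-y : product y * S ≡ product c * S ^ K
    product-y = begin-equality
      product y * S              ≡⟨ cong (_* S) (product-zipWith-* c w (trans length-c (sym length-w))) ⟩
      product c * product w * S  ≡⟨ *-assoc (product c) (product w) S ⟩
      product c * (product w * S)
        ≡⟨ cong (product c *_) (subst₂ (λ P L → product w * P ≡ P ^ L) product-s length-s (product-cofactors s)) ⟩
      product c * S ^ K          ∎
    regroup : ∀ A B T S → A * B * T * S ≡ A * (B * (S * T))
    regroup = solve-∀

  inner-total : sum (zipWith _*_ a w) + sum (zipWith _*_ b w) ≡ K * S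
  inner-total = trans (inner-+ a b w (trans length-a (sym length-b)))
                      (trans (inner-cofactors s) (cong₂ _*_ length-s product-s))

  geomean-positive : ∀ α β → α ^ K ≤ product a → β ^ K ≤ product b → (α + β) ^ K ≤ S
  geomean-positive α β α-bound β-bound =
    *-cancelʳ-≤ _ _ (S ^ k) {{m^n≢0 S k}} (*-cancelˡ-≤ (K ^ K) {{m^n≢0 K K}} (begin
      K ^ K * ((α + β) ^ K * S ^ k)  ≡⟨ sym (*-assoc (K ^ K) _ _) ⟩
      K ^ K * (α + β) ^ K * S ^ k    ≡⟨ cong (_* S ^ k) (sym (^-distribʳ-* K (α + β) K)) ⟩
      (K * (α + β)) ^ K * S ^ k      ≡⟨ cong (λ z → z ^ K * S ^ k) (*-distribˡ-+ K α β) ⟩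
      (K * α + K * β) ^ K * S ^ k
        ≤⟨ RootSum.root-sum k (K * α) (K * β) (S ^ k) (sum (zipWith _*_ a w)) (sum (zipWith _*_ b w))
             (weighted-amgm a α length-a α-bound) (weighted-amgm b β length-b β-bound) ⟩
      (sum (zipWith _*_ a w) + sum (zipWith _*_ b w)) ^ K
                                     ≡⟨ cong (_^ K) inner-total ⟩
      (K * S) ^ K                    ≡⟨ ^-distribʳ-* K S K ⟩
      K ^ K * (S * S ^ k)            ∎))

root-zero : ∀ {k} γ → γ ^ suc k ≤ 0 → γ ≡ 0
root-zero {k} γ h = m^n≡0⇒m≡0 γ (suc k) (n≤0⇒n≡0 h)

geomean-superadditive : ∀ k (a b : List ℕ) → length a ≡ suc k → length b ≡ suc k → ∀ α β →
  α ^ suc k ≤ product a → β ^ suc k ≤ product b → (α + β) ^ suc k ≤ product (zipWith _+_ a b)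
geomean-superadditive k a b length-a length-b α β α-bound β-bound with product (zipWith _+_ a b) in product-s
... | suc S' = GeomeanPositive.geomean-positive k a b length-a length-b S' product-s α β α-bound β-bound
... | zero with product-zipWith-+-zero a b product-s
... | a≡0 , b≡0 rewrite root-zero {k} α (subst (α ^ suc k ≤_) a≡0 α-bound)
                      | root-zero {k} β (subst (β ^ suc k ≤_) b≡0 β-bound) = z≤n

scaled-geomean-superadditive : ∀ k (a b : List ℕ) → length a ≡ suc k → length b ≡ suc k → ∀ P α β →
  α ^ suc k ≤ P * product a → β ^ suc k ≤ P * product b → (α + β) ^ suc k ≤ P * product (zipWith _+_ a b)
scaled-geomean-superadditive k (a₀ ∷ a) (b₀ ∷ b) length-a length-b P α β α-bound β-bound =
  subst ((α + β) ^ suc k ≤_) (factor-out P a₀ b₀ _)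
    (geomean-superadditive k (P * a₀ ∷ a) (P * b₀ ∷ b) length-a length-b α β
      (subst (α ^ suc k ≤_) (sym (*-assoc P a₀ _)) α-bound)
      (subst (β ^ suc k ≤_) (sym (*-assoc P b₀ _)) β-bound))
  where
  factor-out : ∀ P x y Z → (P * x + P * y) * Z ≡ P * ((x + y) * Z)
  factor-out = solve-∀

padding-bound : ∀ e x m → 1 ≤ m → x + m ≤ 2 ^ m → x * 2 ^ e + (m + e) ≤ 2 ^ (m + e)
padding-bound zero    x m _   x+m≤2^m = subst₂ (λ a b → a + b ≤ 2 ^ b) (sym (*-identityʳ x)) (sym (+-identityʳ m)) x+m≤2^m
padding-bound (suc e) x m 1≤m x+m≤2^m = begin
  x * (2 * 2 ^ e) + (m + suc e)   ≡⟨ cong₂ _+_ (double x (2 ^ e)) (+-suc m e) ⟩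
  2 * X + suc M                   ≤⟨ +-monoʳ-≤ (2 * X) (+-mono-≤ (≤-trans 1≤m (m≤m+n m e)) (m≤m+n M 0)) ⟩
  2 * X + (M + (M + 0))           ≡⟨ sym (*-distribˡ-+ 2 X M) ⟩
  2 * (X + M)                     ≤⟨ *-monoʳ-≤ 2 (padding-bound e x m 1≤m x+m≤2^m) ⟩
  2 * 2 ^ M                       ≡⟨ cong (2 ^_) (sym (+-suc m e)) ⟩
  2 ^ (m + suc e)                 ∎
  where
  open ≤-Reasoning
  X = x * 2 ^ e
  M = m + e
  double : ∀ x y → x * (2 * y) ≡ 2 * (x * y)
  double = solve-∀

Test : ℕ → Set
Test n = Subset n → Bool

fix : ∀ {n} → Bool → Test (suc n) → Test n
fix b Q x = Q (b ∷ x)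

#accepted : ∀ {n} → Subset n → Test n → ℕ
#accepted []          Q = if Q [] then 1 else 0
#accepted (true ∷ D)  Q = #accepted D (fix false Q) + #accepted D (fix true Q)
#accepted (false ∷ D) Q = #accepted D (fix false Q)

#accepted-cong : ∀ {n} (D : Subset n) Q Q′ → (∀ x → Q x ≡ Q′ x) → #accepted D Q ≡ #accepted D Q′
#accepted-cong []          Q Q′ Q≗Q′ rewrite Q≗Q′ [] = refl
#accepted-cong (true ∷ D)  Q Q′ Q≗Q′ =
  cong₂ _+_ (#accepted-cong D _ _ (λ x → Q≗Q′ (false ∷ x))) (#accepted-cong D _ _ (λ x → Q≗Q′ (true ∷ x)))
#accepted-cong (false ∷ D) Q Q′ Q≗Q′ = #accepted-cong D _ _ (λ x → Q≗Q′ (false ∷ x))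

-- Q depends only on the coordinates in the window D.
Local : ∀ {n} → Subset n → Test n → Set
Local []      Q = ⊤
Local (d ∷ D) Q = (d ≡ false → ∀ x → fix true Q x ≡ fix false Q x) × Local D (fix false Q) × Local D (fix true Q)

Constraint : ℕ → Set
Constraint n = Subset n × Test n

System : ℕ → Set
System n = List (Constraint n)

LocalSystem : ∀ {n} → System n → Set
LocalSystem = All (λ (D , Q) → Local D Q)

Accepts : ∀ {n} → System n → Subset n → Set
Accepts s x = All (λ (D , Q) → Q x ≡ true) s

bound : ∀ {n} → System n → ℕ
bound s = product (map (λ (D , Q) → #accepted D Q) s)

𝟙 : Bool → ℕ
𝟙 b = if b then 1 else 0

multiplicity : ∀ {n} → Fin n → System n → ℕ
multiplicity j s = sum (map (λ (D , Q) → 𝟙 (lookup D j)) s)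

Covers : ∀ {n} → ℕ → System n → Set
Covers K s = ∀ j → K ≤ multiplicity j s

restrict : ∀ {n} → Bool → System (suc n) → System n
restrict b = map (λ (D , Q) → tail D , fix b Q)

multiplicity-restrict : ∀ {n} b (j : Fin n) s → multiplicity j (restrict b s) ≡ multiplicity (suc j) s
multiplicity-restrict b j []                = refl
multiplicity-restrict b j ((d ∷ D , Q) ∷ s) = cong (𝟙 (lookup D j) +_) (multiplicity-restrict b j s)

covers-restrict : ∀ {n K} b (s : System (suc n)) → Covers K s → Covers K (restrict b s)
covers-restrict {K = K} b s covers j = subst (K ≤_) (sym (multiplicity-restrict b j s)) (covers (suc j))

local-restrict : ∀ {n} b (s : System (suc n)) → LocalSystem s → LocalSystem (restrict b s)
local-restrict b s local = map⁺ (All.map (local-fix b) local)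
  where
  local-fix : ∀ {n} b {c : Constraint (suc n)} → Local (proj₁ c) (proj₂ c) → Local (tail (proj₁ c)) (fix b (proj₂ c))
  local-fix false {d ∷ D , Q} (_ , local₀ , _) = local₀
  local-fix true  {d ∷ D , Q} (_ , _ , local₁) = local₁

accepts-restrict : ∀ {n} b (s : System (suc n)) x → Accepts s (b ∷ x) → Accepts (restrict b s) x
accepts-restrict b s x = map⁺

#accepted-complement : ∀ {n} (D : Subset n) (Q : Test n) →
  #accepted D Q + #accepted D (λ x → not (Q x)) ≡ 2 ^ ∣ D ∣
#accepted-complement []          Q with Q []
... | true  = refl
... | false = refl
#accepted-complement (true ∷ D)  Q = begin
  (a₀ + a₁) + (r₀ + r₁)   ≡⟨ interchange a₀ a₁ r₀ r₁ ⟩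
  (a₀ + r₀) + (a₁ + r₁)   ≡⟨ cong₂ _+_ (#accepted-complement D (fix false Q)) (#accepted-complement D (fix true Q)) ⟩
  2 ^ ∣ D ∣ + 2 ^ ∣ D ∣   ≡⟨ cong (2 ^ ∣ D ∣ +_) (sym (+-identityʳ _)) ⟩
  2 ^ suc ∣ D ∣           ∎
  where
  open ≡-Reasoning
  a₀ = #accepted D (fix false Q)
  a₁ = #accepted D (fix true Q)
  r₀ = #accepted D (λ x → not (fix false Q x))
  r₁ = #accepted D (λ x → not (fix true Q x))
  interchange : ∀ a b c d → (a + b) + (c + d) ≡ (a + c) + (b + d)
  interchange = solve-∀
#accepted-complement (false ∷ D) Q = #accepted-complement D (fix false Q)

bound-++ : ∀ {n} (s t : System n) → bound (s ++ t) ≡ bound s * bound t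
bound-++ s t = trans (cong product (map-++ weight s t)) (product-++ (map weight s) (map weight t))
  where
  weight : Constraint _ → ℕ
  weight (D , Q) = #accepted D Q

multiplicity-++ : ∀ {n} (j : Fin n) (s t : System n) → multiplicity j (s ++ t) ≡ multiplicity j s + multiplicity j t
multiplicity-++ j s t = trans (cong sum (map-++ contains-j s t)) (sum-++ (map contains-j s) (map contains-j t))
  where
  contains-j : Constraint _ → ℕ
  contains-j (D , Q) = 𝟙 (lookup D j)

bound-concat : ∀ {n} m (f : Fin m → System n) c → (∀ i → bound (f i) ≤ c) →
  bound (concat (List.tabulate f)) ≤ c ^ m
bound-concat zero    f c bounded = ≤-refl
bound-concat (suc m) f c bounded =
  ≤-trans (≤-reflexive (bound-++ (f zero) _))
          (*-mono-≤ (bounded zero) (bound-concat m (λ i → f (suc i)) c (λ i → bounded (suc i))))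

multiplicity-concat : ∀ {n} m (f : Fin m → System n) j →
  multiplicity j (concat (List.tabulate f)) ≡ ∑[ i < m ] multiplicity j (f i)
multiplicity-concat zero    f j = refl
multiplicity-concat (suc m) f j =
  trans (multiplicity-++ j (f zero) _) (cong (multiplicity j (f zero) +_) (multiplicity-concat m (λ i → f (suc i)) j))

#accepted-all : ∀ {n} (D : Subset n) → #accepted D (λ _ → true) ≡ 2 ^ ∣ D ∣
#accepted-all []          = refl
#accepted-all (true ∷ D)  = cong₂ _+_ (#accepted-all D) (trans (#accepted-all D) (sym (+-identityʳ _)))
#accepted-all (false ∷ D) = #accepted-all D

local-all : ∀ {n} (D : Subset n) → Local D (λ _ → true)
local-all []      = tt
local-all (d ∷ D) = (λ _ _ → refl) , local-all D , local-all D

-- A factorisation of bound s adapted to the first coordinate: K of the windows containing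
-- coordinate 0 contribute factors aᵢ + bᵢ, where aᵢ resp. bᵢ counts the accepted subsets
-- avoiding resp. containing 0; all other windows are collected in the factor `rest`.
record FirstCoordinateSplit (K : ℕ) {n : ℕ} (s : System (suc n)) : Set where
  field
    as bs     : List ℕ
    rest      : ℕ
    length-as : length as ≡ K
    length-bs : length bs ≡ K
    bound₀    : bound (restrict false s) ≤ rest * product as
    bound₁    : bound (restrict true s) ≤ rest * product bs
    bound-s   : bound s ≡ rest * product (zipWith _+_ as bs)

first-coordinate-split : ∀ {n} K (s : System (suc n)) → LocalSystem s → K ≤ multiplicity zero s →
                         FirstCoordinateSplit K s
first-coordinate-split zero    []    _ _ = record
  { as = [] ; bs = [] ; rest = 1 ; length-as = refl ; length-bs = refl
  ; bound₀ = ≤-refl ; bound₁ = ≤-refl ; bound-s = refl }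
first-coordinate-split zero    ((true ∷ D , Q) ∷ s) (_ ∷ local) _ = record
  { as = as ; bs = bs ; rest = (a + b) * rest ; length-as = length-as ; length-bs = length-bs
  ; bound₀ = ≤-trans (*-mono-≤ (m≤m+n a b) bound₀) (≤-reflexive (sym (*-assoc (a + b) rest _)))
  ; bound₁ = ≤-trans (*-mono-≤ (m≤n+m b a) bound₁) (≤-reflexive (sym (*-assoc (a + b) rest _)))
  ; bound-s = trans (cong ((a + b) *_) bound-s) (sym (*-assoc (a + b) rest _)) }
  -- a further window containing 0 is absorbed into `rest`
  where
  a = #accepted D (fix false Q)
  b = #accepted D (fix true Q)
  open FirstCoordinateSplit (first-coordinate-split zero s local z≤n)
first-coordinate-split (suc K) ((true ∷ D , Q) ∷ s) (_ ∷ local) (s≤s K≤m) = record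
  { as = a ∷ as ; bs = b ∷ bs ; rest = rest ; length-as = cong suc length-as ; length-bs = cong suc length-bs
  ; bound₀ = ≤-trans (*-monoʳ-≤ a bound₀) (≤-reflexive (swap a rest _))
  ; bound₁ = ≤-trans (*-monoʳ-≤ b bound₁) (≤-reflexive (swap b rest _))
  ; bound-s = trans (cong ((a + b) *_) bound-s) (swap (a + b) rest _) }
  where
  a = #accepted D (fix false Q)
  b = #accepted D (fix true Q)
  open FirstCoordinateSplit (first-coordinate-split K s local K≤m)
  swap : ∀ a P X → a * (P * X) ≡ P * (a * X)
  swap = solve-∀
first-coordinate-split K ((false ∷ D , Q) ∷ s) ((independent , _) ∷ local) K≤m = record
  { as = as ; bs = bs ; rest = a * rest ; length-as = length-as ; length-bs = length-bs
  ; bound₀ = ≤-trans (*-monoʳ-≤ a bound₀) (≤-reflexive (sym (*-assoc a rest _)))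
  ; bound₁ = ≤-trans (*-mono-≤ (≤-reflexive same-count) bound₁) (≤-reflexive (sym (*-assoc a rest _)))
  ; bound-s = trans (cong (a *_) bound-s) (sym (*-assoc a rest _)) }
  -- a window avoiding 0 has the same count after fixing 0 either way
  where
  a = #accepted D (fix false Q)
  same-count : #accepted D (fix true Q) ≡ a
  same-count = #accepted-cong D _ _ (independent refl)
  open FirstCoordinateSplit (first-coordinate-split K s local K≤m)

slice : ∀ {n} → Bool → List (Subset (suc n)) → List (Subset n)
slice b     []                = []
slice false ((false ∷ x) ∷ F) = x ∷ slice false F
slice false ((true ∷ x)  ∷ F) = slice false F
slice true  ((false ∷ x) ∷ F) = slice true F
slice true  ((true ∷ x)  ∷ F) = x ∷ slice true F

length-slices : ∀ {n} (F : List (Subset (suc n))) → length F ≡ length (slice false F) + length (slice true F)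
length-slices []                = refl
length-slices ((false ∷ x) ∷ F) = cong suc (length-slices F)
length-slices ((true ∷ x)  ∷ F) = trans (cong suc (length-slices F)) (sym (+-suc _ _))

slice-distinct : ∀ {n} b (x : Subset n) F → All ((b ∷ x) ≢_) F → All (x ≢_) (slice b F)
slice-distinct b     x []                _        = []
slice-distinct false x ((false ∷ y) ∷ F) (p ∷ ps) = (λ x≡y → p (cong (false ∷_) x≡y)) ∷ slice-distinct false x F ps
slice-distinct false x ((true ∷ y)  ∷ F) (_ ∷ ps) = slice-distinct false x F ps
slice-distinct true  x ((false ∷ y) ∷ F) (_ ∷ ps) = slice-distinct true x F ps
slice-distinct true  x ((true ∷ y)  ∷ F) (p ∷ ps) = (λ x≡y → p (cong (true ∷_) x≡y)) ∷ slice-distinct true x F ps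

slice-unique : ∀ {n} b (F : List (Subset (suc n))) → Unique F → Unique (slice b F)
slice-unique b     []                _        = []
slice-unique false ((false ∷ x) ∷ F) (p ∷ ps) = slice-distinct false x F p ∷ slice-unique false F ps
slice-unique false ((true ∷ x)  ∷ F) (_ ∷ ps) = slice-unique false F ps
slice-unique true  ((false ∷ x) ∷ F) (_ ∷ ps) = slice-unique true F ps
slice-unique true  ((true ∷ x)  ∷ F) (p ∷ ps) = slice-distinct true x F p ∷ slice-unique true F ps

slice-accepted : ∀ {n} b (s : System (suc n)) F → All (Accepts s) F → All (Accepts (restrict b s)) (slice b F)
slice-accepted b     s []                _        = []
slice-accepted false s ((false ∷ x) ∷ F) (p ∷ ps) = accepts-restrict false s x p ∷ slice-accepted false s F ps
slice-accepted false s ((true ∷ x)  ∷ F) (_ ∷ ps) = slice-accepted false s F ps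
slice-accepted true  s ((false ∷ x) ∷ F) (_ ∷ ps) = slice-accepted true s F ps
slice-accepted true  s ((true ∷ x)  ∷ F) (p ∷ ps) = accepts-restrict true s x p ∷ slice-accepted true s F ps

bound-dimension-zero : (s : System 0) → Accepts s [] → bound s ≡ 1
bound-dimension-zero []                  []              = refl
bound-dimension-zero (([] , Q) ∷ s) (Q[]≡true ∷ accepted) rewrite Q[]≡true =
  cong (_+ 0) (bound-dimension-zero s accepted)

-- Induction on the dimension: F splits into its two slices along the
-- first coordinate, each bounded by the restricted system, and the two bounds combine
-- by superadditivity of the geometric mean.
shearer : ∀ n k (s : System n) → LocalSystem s → Covers (suc k) s →
          (F : List (Subset n)) → Unique F → All (Accepts s) F → length F ^ suc k ≤ bound s
shearer zero    k s local covers []            _                  _              = z≤n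
shearer zero    k s local covers ([] ∷ [])     _                  (accepted ∷ _) =
  ≤-reflexive (trans (^-zeroˡ (suc k)) (sym (bound-dimension-zero s accepted)))
shearer zero    k s local covers ([] ∷ [] ∷ _) ((distinct ∷ _) ∷ _) _             = contradiction refl distinct
shearer (suc n) k s local covers F unique accepted =
  subst₂ (λ L R → L ^ K ≤ R) (sym (length-slices F)) (sym bound-s)
    (scaled-geomean-superadditive k as bs length-as length-bs rest (length F₀) (length F₁)
      (≤-trans (slice-bound false) bound₀) (≤-trans (slice-bound true) bound₁))
  where
  K = suc k
  open FirstCoordinateSplit (first-coordinate-split K s local (covers zero))
  F₀ = slice false F
  F₁ = slice true F
  slice-bound : ∀ b → length (slice b F) ^ K ≤ bound (restrict b s)
  slice-bound b = shearer n k (restrict b s) (local-restrict b s local) (covers-restrict b s covers)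
                    (slice b F) (slice-unique b F unique) (slice-accepted b s F accepted)

-- The test "x meets T, or x contains at least two elements of S", evaluated one coordinate
-- at a time: `met` records whether x has met T so far and `hits` how many elements of S it
-- has contained so far (both start at false resp. 0).
meets-or-twice : ∀ {n} → Bool → ℕ → Subset n → Subset n → Test n
meets-or-twice met hits []      []      []      = met ∨ (2 ≤ᵇ hits)
meets-or-twice met hits (t ∷ T) (s ∷ S) (x ∷ X) =
  meets-or-twice (met ∨ (t ∧ x)) (hits + 𝟙 (s ∧ x)) T S X

meets-or-twice-local : ∀ {n} met hits (T S : Subset n) → Local (T ∪ S) (meets-or-twice met hits T S)
meets-or-twice-local met hits []      []      = tt
meets-or-twice-local met hits (t ∷ T) (s ∷ S) =
  outside t s , meets-or-twice-local _ _ T S , meets-or-twice-local _ _ T S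
  where
  outside : ∀ t s → t ∨ s ≡ false → ∀ X →
    meets-or-twice met hits (t ∷ T) (s ∷ S) (true ∷ X) ≡ meets-or-twice met hits (t ∷ T) (s ∷ S) (false ∷ X)
  outside false false _ X = refl

accepts-if-met : ∀ {n} hits (T S X : Subset n) → meets-or-twice true hits T S X ≡ true
accepts-if-met hits []      []      []      = refl
accepts-if-met hits (t ∷ T) (s ∷ S) (x ∷ X) = accepts-if-met _ T S X

accepts-if-meets : ∀ {n} met hits {j} (T S X : Subset n) → j ∈ T → j ∈ X → meets-or-twice met hits T S X ≡ true
accepts-if-meets met hits (true ∷ T) (s ∷ S) (true ∷ X) here here =
  subst (λ m → meets-or-twice m _ T S X ≡ true) (sym (∨-zeroʳ met)) (accepts-if-met _ T S X)
accepts-if-meets met hits (t ∷ T) (s ∷ S) (x ∷ X) (there j∈T) (there j∈X) = accepts-if-meets _ _ T S X j∈T j∈X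

accepts-if-two-hits : ∀ {n} met hits (T S X : Subset n) → 2 ≤ hits → meets-or-twice met hits T S X ≡ true
accepts-if-two-hits met hits []      []      []      2≤hits =
  trans (cong (met ∨_) (Equivalence.to T-≡ (≤⇒≤ᵇ 2≤hits))) (∨-zeroʳ met)
accepts-if-two-hits met hits (t ∷ T) (s ∷ S) (x ∷ X) 2≤hits =
  accepts-if-two-hits _ _ T S X (≤-trans 2≤hits (m≤m+n hits _))

accepts-if-hit : ∀ {n} met hits {j} (T S X : Subset n) → 1 ≤ hits → j ∈ S → j ∈ X → meets-or-twice met hits T S X ≡ true
accepts-if-hit met hits (t ∷ T) (true ∷ S) (true ∷ X) 1≤hits here here =
  accepts-if-two-hits _ _ T S X (+-mono-≤ 1≤hits ≤-refl)
accepts-if-hit met hits (t ∷ T) (s ∷ S) (x ∷ X) 1≤hits (there j∈S) (there j∈X) =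
  accepts-if-hit _ _ T S X (≤-trans 1≤hits (m≤m+n hits _)) j∈S j∈X

accepts-if-two : ∀ {n} met hits {j j′} (T S X : Subset n) → j ≢ j′ →
                 j ∈ S → j ∈ X → j′ ∈ S → j′ ∈ X → meets-or-twice met hits T S X ≡ true
accepts-if-two met hits (t ∷ T) (s ∷ S) (x ∷ X) j≢j′ here here here here = contradiction refl j≢j′
accepts-if-two met hits (t ∷ T) (true ∷ S) (true ∷ X) j≢j′ here here (there j′∈S) (there j′∈X) =
  accepts-if-hit _ _ T S X (m≤n+m 1 hits) j′∈S j′∈X
accepts-if-two met hits (t ∷ T) (true ∷ S) (true ∷ X) j≢j′ (there j∈S) (there j∈X) here here =
  accepts-if-hit _ _ T S X (m≤n+m 1 hits) j∈S j∈X
accepts-if-two met hits (t ∷ T) (s ∷ S) (x ∷ X) j≢j′ (there j∈S) (there j∈X) (there j′∈S) (there j′∈X) =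
  accepts-if-two _ _ T S X (λ j≡j′ → j≢j′ (cong suc j≡j′)) j∈S j∈X j′∈S j′∈X

-- The rejected subsets of T ∪ S: after one hit, at least the empty set is rejected …
rejected-after-hit : ∀ {n} (T S : Subset n) → 1 ≤ #accepted (T ∪ S) (λ X → not (meets-or-twice false 1 T S X))
rejected-after-hit []          []          = ≤-refl
rejected-after-hit (false ∷ T) (false ∷ S) = rejected-after-hit T S
rejected-after-hit (false ∷ T) (true ∷ S)  = ≤-trans (rejected-after-hit T S) (m≤m+n _ _)
rejected-after-hit (true ∷ T)  (false ∷ S) = ≤-trans (rejected-after-hit T S) (m≤m+n _ _)
rejected-after-hit (true ∷ T)  (true ∷ S)  = ≤-trans (rejected-after-hit T S) (m≤m+n _ _)

Disjoint : ∀ {n} → Subset n → Subset n → Set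
Disjoint T S = ∀ {j} → j ∈ T → j ∉ S

disjoint-tail : ∀ {n t s} {T S : Subset n} → Disjoint (t ∷ T) (s ∷ S) → Disjoint T S
disjoint-tail disjoint j∈T j∈S = disjoint (there j∈T) (there j∈S)

-- … and from the start, when T and S are disjoint, the empty set and the |S| singletons of S.
rejected-from-start : ∀ {n} (T S : Subset n) → Disjoint T S →
                      suc ∣ S ∣ ≤ #accepted (T ∪ S) (λ X → not (meets-or-twice false 0 T S X))
rejected-from-start []          []          _        = ≤-refl
rejected-from-start (false ∷ T) (false ∷ S) disjoint = rejected-from-start T S (disjoint-tail disjoint)
rejected-from-start (false ∷ T) (true ∷ S)  disjoint =
  ≤-trans (≤-reflexive (+-comm 1 (suc ∣ S ∣)))
          (+-mono-≤ (rejected-from-start T S (disjoint-tail disjoint)) (rejected-after-hit T S))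
rejected-from-start (true ∷ T)  (false ∷ S) disjoint =
  ≤-trans (rejected-from-start T S (disjoint-tail disjoint)) (m≤m+n _ _)
rejected-from-start (true ∷ T)  (true ∷ S)  disjoint = contradiction here (disjoint here)

∣∪∣-disjoint : ∀ {n} (T S : Subset n) → Disjoint T S → ∣ T ∪ S ∣ ≡ ∣ T ∣ + ∣ S ∣
∣∪∣-disjoint []          []          _        = refl
∣∪∣-disjoint (false ∷ T) (false ∷ S) disjoint = ∣∪∣-disjoint T S (disjoint-tail disjoint)
∣∪∣-disjoint (false ∷ T) (true ∷ S)  disjoint = trans (cong suc (∣∪∣-disjoint T S (disjoint-tail disjoint))) (sym (+-suc _ _))
∣∪∣-disjoint (true ∷ T)  (false ∷ S) disjoint = cong suc (∣∪∣-disjoint T S (disjoint-tail disjoint))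
∣∪∣-disjoint (true ∷ T)  (true ∷ S)  disjoint = contradiction here (disjoint here)

#accepted-meets-or-twice : ∀ {n} (T S : Subset n) → Disjoint T S →
  #accepted (T ∪ S) (meets-or-twice false 0 T S) + suc ∣ S ∣ ≤ 2 ^ (∣ T ∣ + ∣ S ∣)
#accepted-meets-or-twice T S disjoint = begin
  #accepted D Q + suc ∣ S ∣                  ≤⟨ +-monoʳ-≤ (#accepted D Q) (rejected-from-start T S disjoint) ⟩
  #accepted D Q + #accepted D (λ X → not (Q X)) ≡⟨ #accepted-complement D Q ⟩
  2 ^ ∣ D ∣                                  ≡⟨ cong (2 ^_) (∣∪∣-disjoint T S disjoint) ⟩
  2 ^ (∣ T ∣ + ∣ S ∣)                        ∎
  where
  open ≤-Reasoning
  D = T ∪ S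
  Q = meets-or-twice false 0 T S

AtMostOneNeighbourIn : ∀ {n} → Graph n → Fin n → Subset n → Set
AtMostOneNeighbourIn G v B = ∀ {w w′} → w ∈ B → adj G v w ≡ true → w′ ∈ B → adj G v w′ ≡ true → w ≡ w′

∈N⁺ : ∀ {n} (G : Graph n) {v w} → adj G v w ≡ true → w ∈ N G v
∈N⁺ G {v} {w} v~w = lookup⇒[]= w (N G v) (trans (lookup∘tabulate (adj G v) w) v~w)

∈N⁻ : ∀ {n} (G : Graph n) {v w} → w ∈ N G v → adj G v w ≡ true
∈N⁻ G {v} {w} w∈N = trans (sym (lookup∘tabulate (adj G v) w)) ([]=⇒lookup w∈N)

-- Adding to B a vertex v with at most one neighbour in B keeps G[B] bipartite:
-- v gets the colour opposite to that neighbour's (any colour if there is none).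
module Extension {n} (G : Graph n) (B : Subset n) (v : Fin n)
                 (bipartite : InducedBipartite G B) (at-most-one : AtMostOneNeighbourIn G v B) where
  c = proj₁ bipartite

  v-colour : Dec (∃ λ w → w ∈ B × adj G v w ≡ true) → Bool
  v-colour (yes (w , _)) = not (c w)
  v-colour (no _)        = true

  neighbour-in-B? : Dec (∃ λ w → w ∈ B × adj G v w ≡ true)
  neighbour-in-B? = any? (λ w → (w ∈? B) ×-dec (adj G v w Bool.≟ true))

  v-colour-proper : ∀ {u} → u ∈ B → adj G v u ≡ true → v-colour neighbour-in-B? ≢ c u
  v-colour-proper {u} u∈B v~u with neighbour-in-B?
  ... | no  none                 = contradiction (u , u∈B , v~u) none
  ... | yes (w , w∈B , v~w) with at-most-one w∈B v~w u∈B v~u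
  ...   | refl = λ same → not-¬ refl (sym same)

  colour : Fin n → Bool
  colour u with u ≟ v
  ... | yes _ = v-colour neighbour-in-B?
  ... | no  _ = c u

  old-vertex : ∀ {u} → u ∈ B ∪ ⁅ v ⁆ → u ≢ v → u ∈ B
  old-vertex {u} u∈B∪v u≢v with x∈p∪q⁻ B ⁅ v ⁆ u∈B∪v
  ... | inj₁ u∈B = u∈B
  ... | inj₂ u∈v = contradiction (x∈⁅y⁆⇒x≡y v u∈v) u≢v

  proper : ∀ u₁ u₂ → u₁ ∈ B ∪ ⁅ v ⁆ → u₂ ∈ B ∪ ⁅ v ⁆ → adj G u₁ u₂ ≡ true → colour u₁ ≢ colour u₂
  proper u₁ u₂ m₁ m₂ u₁~u₂ with u₁ ≟ v | u₂ ≟ v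
  ... | yes refl | yes refl = λ _ → contradiction (trans (sym u₁~u₂) (irrfl G u₁)) λ ()
  ... | yes refl | no u₂≢v  = v-colour-proper (old-vertex m₂ u₂≢v) u₁~u₂
  ... | no u₁≢v  | yes refl = λ same → v-colour-proper (old-vertex m₁ u₁≢v) (trans (Graph.sym G u₂ u₁) u₁~u₂) (sym same)
  ... | no u₁≢v  | no u₂≢v  = proj₂ bipartite u₁ u₂ (old-vertex m₁ u₁≢v) (old-vertex m₂ u₂≢v) u₁~u₂

  extended : InducedBipartite G (B ∪ ⁅ v ⁆)
  extended = colour , proper

maximal-absorbs : ∀ {n} (G : Graph n) {S v} → MaximalBipartite G S → AtMostOneNeighbourIn G v S → v ∈ S
maximal-absorbs G {S} {v} (bipartite , maximal) at-most-one =
  subst (v ∈_) (maximal (S ∪ ⁅ v ⁆) (p⊆p∪q ⁅ v ⁆) (Extension.extended G S v bipartite at-most-one))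
        (x∈p∪q⁺ (inj₂ (x∈⁅x⁆ v)))

vertex-test : ∀ {n} → Graph n → Fin n → Test n
vertex-test G v = meets-or-twice false 0 ⁅ v ⁆ (N G v)

-- Every superset T of a maximal bipartite set passes every vertex test: otherwise v ∉ T
-- and v has at most one neighbour in T, hence in S ⊆ T, so v ∈ S by maximality.
up-closure-passes : ∀ {n} (G : Graph n) {T} → InUpMax G T → ∀ v → vertex-test G v T ≡ true
up-closure-passes G {T} (S , maximal , S⊆T) v with vertex-test G v T in rejected
... | true  = refl
... | false = contradiction (S⊆T (maximal-absorbs G maximal at-most-one-in-S)) v∉T
  where
  v∉T : v ∉ T
  v∉T v∈T = contradiction (trans (sym (accepts-if-meets false 0 ⁅ v ⁆ (N G v) T (x∈⁅x⁆ v) v∈T)) rejected) λ ()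
  at-most-one-in-S : AtMostOneNeighbourIn G v S
  at-most-one-in-S {w} {w′} w∈S v~w w′∈S v~w′ with w ≟ w′
  ... | yes w≡w′ = w≡w′
  ... | no  w≢w′ = contradiction
        (trans (sym (accepts-if-two false 0 ⁅ v ⁆ (N G v) T w≢w′
                       (∈N⁺ G v~w) (S⊆T w∈S) (∈N⁺ G v~w′) (S⊆T w′∈S))) rejected)
        λ ()

∑-mono-≤ : ∀ m (f g : Fin m → ℕ) → (∀ i → f i ≤ g i) → ∑[ i < m ] f i ≤ ∑[ i < m ] g i
∑-mono-≤ zero    f g f≤g = ≤-refl
∑-mono-≤ (suc m) f g f≤g =
  +-mono-≤ (f≤g zero) (∑-mono-≤ m (λ i → f (suc i)) (λ i → g (suc i)) (λ i → f≤g (suc i)))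

∑-singleton : ∀ {n} (u : Fin n) (g : Fin n → ℕ) → ∑[ v < n ] (if lookup ⁅ v ⁆ u then g v else 0) ≡ g u
∑-singleton {suc n} zero    g = trans (cong (g zero +_) (∑-zero n)) (+-identityʳ (g zero))
  where
  ∑-zero : ∀ n → ∑[ i < n ] 0 ≡ 0
  ∑-zero zero    = refl
  ∑-zero (suc n) = ∑-zero n
∑-singleton {suc n} (suc u) g rewrite lookup-replicate u false = ∑-singleton u (λ i → g (suc i))

∣tabulate∣ : ∀ {m} (f : Fin m → Bool) → ∣ tabulate f ∣ ≡ ∑[ i < m ] 𝟙 (f i)
∣tabulate∣ {zero}  f = refl
∣tabulate∣ {suc m} f with f zero
... | true  = cong suc (∣tabulate∣ (λ i → f (suc i)))
... | false = ∣tabulate∣ (λ i → f (suc i))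

-- The system of constraints of a graph G all of whose degrees are at most Δ: for each
-- vertex v, the window ⁅v⁆ ∪ N(v) with the vertex test, padded by Δ − deg v trivial
-- constraints on ⁅v⁆, so that every vertex is covered at least Δ + 1 times.
module GraphSystem {n} (G : Graph n) (Δ : ℕ) (deg≤Δ : ∀ v → deg G v ≤ Δ) where

  trivial : Fin n → Constraint n
  trivial v = ⁅ v ⁆ , λ _ → true

  constraints-of : Fin n → System n
  constraints-of v = (⁅ v ⁆ ∪ N G v , vertex-test G v) ∷ replicate (Δ ∸ deg G v) (trivial v)

  system : System n
  system = concat (List.tabulate constraints-of)

  system-local : LocalSystem system
  system-local = concat⁺ (tabulate⁺ λ v →
    meets-or-twice-local false 0 ⁅ v ⁆ (N G v) ∷ replicate⁺ (Δ ∸ deg G v) (local-all ⁅ v ⁆))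

  system-accepts : ∀ {T} → InUpMax G T → Accepts system T
  system-accepts T∈↑max = concat⁺ (tabulate⁺ λ v →
    up-closure-passes G T∈↑max v ∷ replicate⁺ (Δ ∸ deg G v) refl)

  multiplicity-trivials : ∀ r v u → multiplicity u (replicate r (trivial v)) ≡ r * 𝟙 (lookup ⁅ v ⁆ u)
  multiplicity-trivials r v u =
    trans (cong sum (map-replicate (λ (D , Q) → 𝟙 (lookup D u)) r (trivial v))) (sum-replicate r _)

  -- u lies in the window of each of its neighbours, and in the window and the padding of u itself.
  constraints-multiplicity : ∀ u v →
    𝟙 (adj G u v) + (if lookup ⁅ v ⁆ u then suc (Δ ∸ deg G v) else 0) ≤ multiplicity u (constraints-of v)
  constraints-multiplicity u v = begin
    𝟙 (adj G u v) + (if a then suc e else 0)  ≡⟨ cong (λ b → 𝟙 b + (if a then suc e else 0)) (Graph.sym G u v) ⟩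
    𝟙 (adj G v u) + (if a then suc e else 0)  ≤⟨ indicator-bound a (adj G v u) loop-free ⟩
    𝟙 (a ∨ adj G v u) + e * 𝟙 a               ≡⟨ cong₂ _+_ (cong 𝟙 (sym lookup-window)) (sym (multiplicity-trivials e v u)) ⟩
    multiplicity u (constraints-of v)         ∎
    where
    open ≤-Reasoning
    a = lookup ⁅ v ⁆ u
    e = Δ ∸ deg G v
    lookup-window : lookup (⁅ v ⁆ ∪ N G v) u ≡ a ∨ adj G v u
    lookup-window = trans (lookup-zipWith _∨_ u ⁅ v ⁆ (N G v)) (cong (a ∨_) (lookup∘tabulate (adj G v) u))
    loop-free : a ≡ true → adj G v u ≡ false
    loop-free a≡true with x∈⁅y⁆⇒x≡y v (lookup⇒[]= u ⁅ v ⁆ a≡true)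
    ... | refl = irrfl G u
    indicator-bound : ∀ a b → (a ≡ true → b ≡ false) → 𝟙 b + (if a then suc e else 0) ≤ 𝟙 (a ∨ b) + e * 𝟙 a
    indicator-bound true  b b-false rewrite b-false refl = s≤s (≤-reflexive (sym (*-identityʳ e)))
    indicator-bound false b _ = +-monoʳ-≤ (𝟙 b) z≤n

  system-covers : Covers (suc Δ) system
  system-covers u = begin
    suc Δ                             ≡⟨ cong suc (sym (m+[n∸m]≡n (deg≤Δ u))) ⟩
    suc (deg G u + (Δ ∸ deg G u))     ≡⟨ sym (+-suc (deg G u) _) ⟩
    deg G u + suc (Δ ∸ deg G u)       ≡⟨ cong₂ _+_ (∣tabulate∣ (adj G u)) (sym (∑-singleton u (λ v → suc (Δ ∸ deg G v)))) ⟩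
    ∑[ v < n ] 𝟙 (adj G u v) + ∑[ v < n ] (if lookup ⁅ v ⁆ u then suc (Δ ∸ deg G v) else 0)
                                      ≡⟨ sym (∑-distrib-+ (λ v → 𝟙 (adj G u v)) own-padding) ⟩
    ∑[ v < n ] (𝟙 (adj G u v) + (if lookup ⁅ v ⁆ u then suc (Δ ∸ deg G v) else 0))
                                      ≤⟨ ∑-mono-≤ n _ _ (constraints-multiplicity u) ⟩
    ∑[ v < n ] multiplicity u (constraints-of v)
                                      ≡⟨ sym (multiplicity-concat n constraints-of u) ⟩
    multiplicity u system             ∎
    where
    open ≤-Reasoning
    own-padding : Fin n → ℕ
    own-padding v = if lookup ⁅ v ⁆ u then suc (Δ ∸ deg G v) else 0

  -- The window of v has 1 + deg v elements, of which the vertex test rejects at least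
  -- 1 + deg v subsets; the padding contributes a factor 2 per trivial constraint.
  constraints-bound : ∀ v → bound (constraints-of v) ≤ 2 ^ suc Δ ∸ Δ ∸ 1
  constraints-bound v = subst (bound (constraints-of v) ≤_) subtract-separately
    (m+n≤o⇒m≤o∸n (bound (constraints-of v)) (subst (λ m → bound (constraints-of v) + m ≤ 2 ^ m) size padded))
    where
    subtract-separately : 2 ^ suc Δ ∸ suc Δ ≡ 2 ^ suc Δ ∸ Δ ∸ 1
    subtract-separately = trans (cong (2 ^ suc Δ ∸_) (+-comm 1 Δ)) (sym (∸-+-assoc (2 ^ suc Δ) Δ 1))
    d = deg G v
    e = Δ ∸ d
    x = #accepted (⁅ v ⁆ ∪ N G v) (vertex-test G v)
    disjoint : Disjoint ⁅ v ⁆ (N G v)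
    disjoint j∈v j∈N with x∈⁅y⁆⇒x≡y v j∈v
    ... | refl = contradiction (trans (sym (∈N⁻ G j∈N)) (irrfl G v)) λ ()
    window-bound : x + suc d ≤ 2 ^ suc d
    window-bound = subst (λ k → x + suc d ≤ 2 ^ (k + d)) (∣⁅x⁆∣≡1 v)
                     (#accepted-meets-or-twice ⁅ v ⁆ (N G v) disjoint)
    padding : bound (replicate e (trivial v)) ≡ 2 ^ e
    padding = trans (cong product (map-replicate (λ (D , Q) → #accepted D Q) e (trivial v)))
                    (trans (product-replicate e _) (cong (_^ e) (trans (#accepted-all ⁅ v ⁆) (cong (2 ^_) (∣⁅x⁆∣≡1 v)))))
    padded : bound (constraints-of v) + (suc d + e) ≤ 2 ^ (suc d + e)
    padded = subst (λ y → x * y + (suc d + e) ≤ 2 ^ (suc d + e)) (sym padding)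
               (padding-bound e x (suc d) (s≤s z≤n) window-bound)
    size : suc d + e ≡ suc Δ
    size = cong suc (m+[n∸m]≡n (deg≤Δ v))

  system-bound : bound system ≤ (2 ^ suc Δ ∸ Δ ∸ 1) ^ n
  system-bound = bound-concat n constraints-of _ constraints-bound

theorem3p8 : ∀ (n : ℕ) (G : Graph n) (Δ : ℕ) → MaxDegree G Δ →
    ∀ (Ts : List (Subset n)) → Unique Ts → All (InUpMax G) Ts →
    length Ts ^ suc Δ ≤ (2 ^ suc Δ ∸ Δ ∸ 1) ^ n
theorem3p8 n G Δ (deg≤Δ , _) Ts unique Ts⊆↑max =
  ≤-trans (shearer n Δ system system-local system-covers Ts unique (All.map system-accepts Ts⊆↑max))
          system-bound
  where open GraphSystem G Δ deg≤Δ
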